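{- Let $X$ be a $(95,40,12,20)$ strongly regular graph and let $K$ be a $4$-clique of $X$ that is not contained in any $5$-clique of $X$. For $i\in\{0,1,2,3\}$ let $X_i$ be the set of vertices of $V(X)\setminus V(K)$ having exactly $i$ neighbours in $K$, and suppose $(|X_0|,|X_1|,|X_2|,|X_3|)=(3,28,60,0)$. Write $X_0=\{x_1,x_2,x_3\}$ and for $1\le i<j\le 3$ let $X_{i,j}=N(x_i)\cap N(x_j)$. Then each of the induced subgraphs $X[X_{1,2}]$, $X[X_{1,3}]$, $X[X_{2,3}]$ is a disjoint union of cycles, and the induced subgraph $X[X_{1,2}\cup X_{1,3}\cup X_{2,3}]$ is $22$-regular.
   Context: A $k$-regular graph $G$ on $v$ vertices is a $(v,k,\lambda,\mu)$ strongly regular graph if any two distinct adjacent vertices have exactly $\lambda$ common neighbours and any two distinct non-adjacent vertices have exactly $\mu$ common neighbours. $N(x)$ denotes the set of neighbours of $x$ in $X$, and $X[S]$ the subgraph of $X$ induced on $S$. -}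

module Defs where

open import Data.Nat using (ℕ)
open import Data.Bool using (Bool; true; false)
open import Data.Fin using (Fin)
open import Data.Fin.Subset using (Subset; _∈_; _∉_; _⊆_; _∩_; ∣_∣)
open import Data.Vec using (tabulate)
open import Data.Product using (Σ; _×_)
open import Data.Sum using (_⊎_)
open import Relation.Binary.PropositionalEquality using (_≡_; _≢_)
open import Function.Bundles using (_⇔_)

record SimpleGraph (n : ℕ) : Set where
  field
    adj    : Fin n → Fin n → Bool
    sym    : ∀ x y → adj x y ≡ adj y x
    irrefl : ∀ x → adj x x ≡ false

module _ {n : ℕ} (G : SimpleGraph n) where
  open SimpleGraph G

  Adj : Fin n → Fin n → Set
  Adj x y = adj x y ≡ true

  N : Fin n → Subset n
  N x = tabulate (adj x)

  -- (n, k, λ, μ) strongly regular (the vertex count is n itself)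
  IsSRG : ℕ → ℕ → ℕ → Set
  IsSRG k l m =
    (∀ x → ∣ N x ∣ ≡ k) ×
    (∀ x y → x ≢ y → Adj x y → ∣ N x ∩ N y ∣ ≡ l) ×
    (∀ x y → x ≢ y → adj x y ≡ false → ∣ N x ∩ N y ∣ ≡ m)

  IsClique : Subset n → Set
  IsClique C = ∀ x y → x ∈ C → y ∈ C → x ≢ y → Adj x y

  IsClique-of-size : ℕ → Subset n → Set
  IsClique-of-size s C = IsClique C × ∣ C ∣ ≡ s

  -- The induced subgraph X[S] is a disjoint union of cycles:
  -- there is a permutation σ of S without fixed points or 2-cycles
  -- whose cycles are exactly the cycles of X[S], i.e. for x, y ∈ S,
  -- x ~ y iff y = σ x or x = σ y.
  IsDisjointUnionOfCycles : Subset n → Set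
  IsDisjointUnionOfCycles S =
    Σ (Fin n → Fin n) λ σ →
      (∀ x → x ∈ S → σ x ∈ S) ×
      (∀ x y → x ∈ S → y ∈ S → σ x ≡ σ y → x ≡ y) ×
      (∀ x → x ∈ S → σ x ≢ x) ×
      (∀ x → x ∈ S → σ (σ x) ≢ x) ×
      (∀ x y → x ∈ S → y ∈ S → (Adj x y ⇔ (y ≡ σ x ⊎ x ≡ σ y)))

  IsRegularOn : Subset n → ℕ → Set
  IsRegularOn S r = ∀ x → x ∈ S → ∣ N x ∩ S ∣ ≡ r

  Layer : Subset n → ℕ → Subset n
  Layer K i = tabulate λ x → outside x
    where
      open import Data.Bool using (_∧_; not)
      open import Data.Nat using (_≡ᵇ_)
      open import Data.Vec using (lookup)
      outside : Fin n → Bool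
      outside x = not (lookup K x) ∧ (∣ N x ∩ K ∣ ≡ᵇ i)

module Submission where

-- Every vertex outside K has at most two neighbours in K: three is excluded by X₃ = ∅ and
-- four by the maximality of K, while the vertices of K have three. For x ∈ X₀, counting the
-- paths x – z – k with k ∈ K in two ways gives ∑_{z ~ x} |N(z) ∩ K| = 4μ = 80 = 2 deg x, so
-- every neighbour of x lies in X₂; hence x₁, x₂, x₃ are pairwise non-adjacent with μ = 20
-- common neighbours. Let d(z) be the number of xᵢ adjacent to z and e(z) the number of pairs
-- of them. Then 4d ≤ 3e + 5 on X₂ with equality iff d = 2, and both sides sum to 480 over
-- X₂, so every vertex of X₂ is adjacent to exactly two of the xᵢ: the sets X_{i,j} partition
-- X₂. For y ∈ X₂ (two neighbours in K, two in X₀) the same double counting gives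
-- |N(y) ∩ X₂| = 22, and then |N(y) ∩ X_{1,2}| = λ + λ − 22 = 2 for y ∈ X_{1,2}.
-- Finally, a finite 2-regular graph is a disjoint union of cycles, by induction on its size:
-- if the two neighbours a, b of a vertex v are non-adjacent, delete v and join a to b; an
-- orientation of the smaller graph runs along the new edge, and v is inserted there.
-- Otherwise v, a, b form a triangle component, oriented as a 3-cycle beside the rest.

open import Defs
open import Data.Bool using (Bool; true; false; _∧_; _∨_; not)
open import Data.Bool.Properties using (T-≡; ¬-not)
open import Data.Empty using (⊥-elim)
open import Data.Fin using (Fin; zero; suc; _≟_)
open import Data.Fin.Subset
  using (Subset; _∈_; _∉_; _⊆_; _∩_; _∪_; _-_; ⁅_⁆; ∣_∣; inside; outside; Nonempty; Empty)
open import Data.Fin.Subset.Properties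
  using ( _∈?_; nonempty?; Empty-unique; ∣⊥∣≡0; p─⊥≡p; p─q⊆p; ⊆-antisym; p⊆q⇒∣p∣≤∣q∣
        ; x∈⁅x⁆; x∈⁅y⁆⇒x≡y; x∈p∩q⁺; x∈p∩q⁻; x∈p∪q⁺; x∈p∪q⁻; x∈p∧x≢y⇒x∈p-y
        ; x∈p⇒∣p-x∣<∣p∣; ∣p─q∣≤∣p∣; ∣p∩q∣≤∣q∣)
open import Data.Nat using (ℕ; zero; suc; _+_; _*_; _≤_; _<_; z≤n; s≤s; _≡ᵇ_)
open import Data.Nat.Induction using (<-wellFounded)
open import Data.Nat.Properties
  using ( +-*-semiring; *-commutativeSemigroup; suc-injective; ≡⇒≡ᵇ; ≡ᵇ⇒≡
        ; +-identityʳ; *-identityʳ; *-zeroʳ; *-comm; *-distribˡ-+; +-cancelˡ-≡; +-cancelʳ-≡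
        ; ≤-refl; ≤-reflexive; ≤-trans; ≤-antisym; ≤-<-trans; <-irrefl; m≤m+n
        ; +-mono-≤; +-monoʳ-≤; *-monoʳ-≤; +-cancelʳ-≤)
open import Data.Product using (∃; ∃₂; _×_; _,_; proj₁; proj₂)
open import Data.Sum as Sum using (_⊎_; inj₁; inj₂; [_,_])
open import Data.Vec using ([]; _∷_; lookup; replicate; here; there)
open import Data.Vec.Properties
  using ( []=⇒lookup; lookup⇒[]=; lookup-zipWith; lookup∘tabulate; lookup-replicate
        ; tabulate∘lookup; tabulate-cong)
open import Function using (_∘_; id; case_of_)
open import Function.Bundles using (_⇔_; mk⇔; Equivalence)
open import Induction.WellFounded using (Acc; acc)
open import Level using (0ℓ)
open import Relation.Binary using (Rel; Symmetric)
open import Relation.Binary.PropositionalEquality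
  using (_≡_; _≢_; refl; sym; trans; cong; cong₂; subst; module ≡-Reasoning)
open import Relation.Nullary using (¬_; Dec; yes; no)

open import Algebra.Properties.CommutativeSemigroup *-commutativeSemigroup
  using (x∙yz≈y∙xz; x∙yz≈y∙zx)
open import Algebra.Properties.Semiring.Sum +-*-semiring
  using (sum; sum-cong-≗; ∑-distrib-+; ∑-comm; *-distribˡ-sum; sum-replicate-zero)

open Equivalence using (to; from)

-- Finite sums and subsets

𝟙 : Bool → ℕ
𝟙 true  = 1
𝟙 false = 0

∑-mono-≤ : ∀ {n} {f g : Fin n → ℕ} → (∀ i → f i ≤ g i) → sum f ≤ sum g
∑-mono-≤ {zero}  f≤g = z≤n
∑-mono-≤ {suc n} f≤g = +-mono-≤ (f≤g zero) (∑-mono-≤ (f≤g ∘ suc))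

+-tight : ∀ {a b c d} → a ≤ c → b ≤ d → a + b ≡ c + d → a ≡ c × b ≡ d
+-tight {a} {b} {c} {d} a≤c b≤d eq = a≡c , +-cancelˡ-≡ a b d (trans eq (cong (_+ d) (sym a≡c)))
  where
    a≡c : a ≡ c
    a≡c = ≤-antisym a≤c (+-cancelʳ-≤ d c a (≤-trans (≤-reflexive (sym eq)) (+-monoʳ-≤ a b≤d)))

∑-tight : ∀ {n} {f g : Fin n → ℕ} → (∀ i → f i ≤ g i) → sum f ≡ sum g → ∀ i → f i ≡ g i
∑-tight {suc n} f≤g eq i with +-tight (f≤g zero) (∑-mono-≤ (f≤g ∘ suc)) eq
∑-tight {suc n} f≤g eq zero    | f₀≡g₀ , _ = f₀≡g₀
∑-tight {suc n} f≤g eq (suc i) | _ , rest  = ∑-tight (f≤g ∘ suc) rest i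

∑-distrib-+₃ : ∀ {n} (f g h : Fin n → ℕ) → sum (λ i → f i + g i + h i) ≡ sum f + sum g + sum h
∑-distrib-+₃ f g h = trans (∑-distrib-+ (λ i → f i + g i) h) (cong (_+ sum h) (∑-distrib-+ f g))

∈⇒lookup≡true : ∀ {n} {p : Subset n} {x} → x ∈ p → lookup p x ≡ true
∈⇒lookup≡true = []=⇒lookup

lookup≡true⇒∈ : ∀ {n} {p : Subset n} {x} → lookup p x ≡ true → x ∈ p
lookup≡true⇒∈ = lookup⇒[]= _ _

∉⇒lookup≡false : ∀ {n} {p : Subset n} {x} → x ∉ p → lookup p x ≡ false
∉⇒lookup≡false x∉p = ¬-not (x∉p ∘ lookup≡true⇒∈)

lookup≡false⇒∉ : ∀ {n} {p : Subset n} {x} → lookup p x ≡ false → x ∉ p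
lookup≡false⇒∉ x∉p x∈p with () ← trans (sym x∉p) (∈⇒lookup≡true x∈p)

lookup-∩ : ∀ {n} (p q : Subset n) z → lookup (p ∩ q) z ≡ lookup p z ∧ lookup q z
lookup-∩ p q z = lookup-zipWith _∧_ z p q

lookup-∪ : ∀ {n} (p q : Subset n) z → lookup (p ∪ q) z ≡ lookup p z ∨ lookup q z
lookup-∪ p q z = lookup-zipWith _∨_ z p q

𝟙-∧ : ∀ p q → 𝟙 (p ∧ q) ≡ 𝟙 p * 𝟙 q
𝟙-∧ true  q = sym (+-identityʳ (𝟙 q))
𝟙-∧ false q = refl

𝟙-lookup-∪ : ∀ {n} (p q : Subset n) {z} → (z ∈ p → z ∉ q) →
  𝟙 (lookup (p ∪ q) z) ≡ 𝟙 (lookup p z) + 𝟙 (lookup q z)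
𝟙-lookup-∪ p q {z} disjoint rewrite lookup-∪ p q z with lookup p z in z∈p | lookup q z in z∈q
... | true  | true  = ⊥-elim (disjoint (lookup≡true⇒∈ z∈p) (lookup≡true⇒∈ z∈q))
... | true  | false = refl
... | false | true  = refl
... | false | false = refl

∣p∣≡∑ : ∀ {n} (p : Subset n) → ∣ p ∣ ≡ sum (𝟙 ∘ lookup p)
∣p∣≡∑ []            = refl
∣p∣≡∑ (inside  ∷ p) = cong suc (∣p∣≡∑ p)
∣p∣≡∑ (outside ∷ p) = ∣p∣≡∑ p

∣p∩q∣≡∑ : ∀ {n} (p q : Subset n) → ∣ p ∩ q ∣ ≡ sum (λ z → 𝟙 (lookup p z) * 𝟙 (lookup q z))
∣p∩q∣≡∑ p q = trans (∣p∣≡∑ (p ∩ q))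
  (sum-cong-≗ λ z → trans (cong 𝟙 (lookup-∩ p q z)) (𝟙-∧ (lookup p z) (lookup q z)))

∑-⁅⁆ : ∀ {n} (f : Fin n → ℕ) x → sum (λ z → f z * 𝟙 (lookup ⁅ x ⁆ z)) ≡ f x
∑-⁅⁆ {suc n} f zero = trans (cong₂ _+_ (*-identityʳ (f zero)) rest≡0) (+-identityʳ (f zero))
  where
    rest≡0 : sum (λ z → f (suc z) * 𝟙 (lookup (replicate n false) z)) ≡ 0
    rest≡0 = trans (sum-cong-≗ λ z → trans (cong (λ b → f (suc z) * 𝟙 b) (lookup-replicate z false))
                                           (*-zeroʳ (f (suc z))))
                   (sum-replicate-zero n)
∑-⁅⁆ {suc n} f (suc x) = cong₂ _+_ (*-zeroʳ (f zero)) (∑-⁅⁆ (f ∘ suc) x)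

x∉p-x : ∀ {n} (p : Subset n) x → x ∉ p - x
x∉p-x (s ∷ p) zero    ()
x∉p-x (s ∷ p) (suc x) (there x∈p-x) = x∉p-x p x x∈p-x

x∈p-y⁻ : ∀ {n} {p : Subset n} {x y} → x ∈ p - y → x ∈ p × x ≢ y
x∈p-y⁻ {p = p} {y = y} x∈p-y = p─q⊆p p ⁅ y ⁆ x∈p-y , λ { refl → x∉p-x p y x∈p-y }

x∈p⇒suc∣p-x∣≡∣p∣ : ∀ {n} {p : Subset n} {x} → x ∈ p → suc ∣ p - x ∣ ≡ ∣ p ∣
x∈p⇒suc∣p-x∣≡∣p∣ {p = inside  ∷ p} here        = cong (suc ∘ ∣_∣) (p─⊥≡p p)
x∈p⇒suc∣p-x∣≡∣p∣ {p = inside  ∷ p} (there x∈p) = cong suc (x∈p⇒suc∣p-x∣≡∣p∣ x∈p)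
x∈p⇒suc∣p-x∣≡∣p∣ {p = outside ∷ p} (there x∈p) = x∈p⇒suc∣p-x∣≡∣p∣ x∈p

∣p∣≡0⇒x∉p : ∀ {n} {p : Subset n} {x} → ∣ p ∣ ≡ 0 → x ∉ p
∣p∣≡0⇒x∉p {p = p} {x} ∣p∣≡0 x∈p with () ← subst (∣ p - x ∣ <_) ∣p∣≡0 (x∈p⇒∣p-x∣<∣p∣ x∈p)

∣p∣≡suc⇒∃ : ∀ {n} {p : Subset n} {m} → ∣ p ∣ ≡ suc m → ∃ λ x → x ∈ p × ∣ p - x ∣ ≡ m
∣p∣≡suc⇒∃ {n} {p} ∣p∣≡1+m with nonempty? p
... | yes (x , x∈p) = x , x∈p , suc-injective (trans (x∈p⇒suc∣p-x∣≡∣p∣ x∈p) ∣p∣≡1+m)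
... | no empty with () ← trans (sym ∣p∣≡1+m) (trans (cong ∣_∣ (Empty-unique empty)) (∣⊥∣≡0 n))

∣p∣≡2⇒pair : ∀ {n} {p : Subset n} → ∣ p ∣ ≡ 2 →
  ∃₂ λ a b → a ≢ b × a ∈ p × b ∈ p × (∀ {y} → y ∈ p → y ≡ a ⊎ y ≡ b)
∣p∣≡2⇒pair {p = p} ∣p∣≡2 with ∣p∣≡suc⇒∃ ∣p∣≡2
... | a , a∈p , ∣p-a∣≡1 with ∣p∣≡suc⇒∃ {p = p - a} ∣p-a∣≡1
...   | b , b∈p-a , ∣p-a-b∣≡0 = a , b , a≢b , a∈p , proj₁ (x∈p-y⁻ {p = p} b∈p-a) , only
  where
    a≢b : a ≢ b
    a≢b a≡b = proj₂ (x∈p-y⁻ {p = p} b∈p-a) (sym a≡b)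
    only : ∀ {y} → y ∈ p → y ≡ a ⊎ y ≡ b
    only {y} y∈p with y ≟ a | y ≟ b
    ... | yes y≡a | _       = inj₁ y≡a
    ... | no _    | yes y≡b = inj₂ y≡b
    ... | no y≢a  | no y≢b  =
      ⊥-elim (∣p∣≡0⇒x∉p ∣p-a-b∣≡0 (x∈p∧x≢y⇒x∈p-y (x∈p∧x≢y⇒x∈p-y y∈p y≢a) y≢b))

∣p∩q∣≡∣q∣⇒q⊆p : ∀ {n} {p q : Subset n} → ∣ p ∩ q ∣ ≡ ∣ q ∣ → q ⊆ p
∣p∩q∣≡∣q∣⇒q⊆p {p = p} {q} eq {x} x∈q with x ∈? p
... | yes x∈p = x∈p
... | no x∉p = ⊥-elim (<-irrefl eq (≤-<-trans (p⊆q⇒∣p∣≤∣q∣ p∩q⊆q-x) (x∈p⇒∣p-x∣<∣p∣ x∈q)))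
  where
    p∩q⊆q-x : p ∩ q ⊆ q - x
    p∩q⊆q-x y∈p∩q with x∈p∩q⁻ p q y∈p∩q
    ... | y∈p , y∈q = x∈p∧x≢y⇒x∈p-y y∈q λ { refl → x∉p y∈p }

x∉p⇒p∪⁅x⁆-x≡p : ∀ {n} {p : Subset n} {x} → x ∉ p → (p ∪ ⁅ x ⁆) - x ≡ p
x∉p⇒p∪⁅x⁆-x≡p {p = p} {x} x∉p = ⊆-antisym ⊆p p⊆
  where
    ⊆p : (p ∪ ⁅ x ⁆) - x ⊆ p
    ⊆p y∈ with x∈p-y⁻ {p = p ∪ ⁅ x ⁆} y∈
    ... | y∈p∪x , y≢x with x∈p∪q⁻ p ⁅ x ⁆ y∈p∪x
    ...   | inj₁ y∈p = y∈p
    ...   | inj₂ y∈x = ⊥-elim (y≢x (x∈⁅y⁆⇒x≡y x y∈x))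
    p⊆ : p ⊆ (p ∪ ⁅ x ⁆) - x
    p⊆ y∈p = x∈p∧x≢y⇒x∈p-y (x∈p∪q⁺ (inj₁ y∈p)) λ { refl → x∉p y∈p }

-- 2-regular graphs are disjoint unions of cycles

record NeighboursIn {n} (E : Rel (Fin n) 0ℓ) (S : Subset n) (x a b : Fin n) : Set where
  field
    distinct : a ≢ b
    a∈S      : a ∈ S
    b∈S      : b ∈ S
    edge-a   : E x a
    edge-b   : E x b
    only     : ∀ {y} → y ∈ S → E x y → y ≡ a ⊎ y ≡ b

open NeighboursIn

TwoRegular : ∀ {n} → Rel (Fin n) 0ℓ → Subset n → Set
TwoRegular E S = ∀ {x} → x ∈ S → ∃₂ (NeighboursIn E S x)

-- The invariant of the induction. IsDisjointUnionOfCycles also asks σ to have no fixed points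
-- and no 2-cycles, which follow from irreflexivity and 2-regularity.
record Orientation {n} (E : Rel (Fin n) 0ℓ) (S : Subset n) (σ : Fin n → Fin n) : Set where
  field
    closed    : ∀ {x} → x ∈ S → σ x ∈ S
    injective : ∀ {x y} → x ∈ S → y ∈ S → σ x ≡ σ y → x ≡ y
    edge⇔     : ∀ {x y} → x ∈ S → y ∈ S → E x y ⇔ (y ≡ σ x ⊎ x ≡ σ y)

open Orientation

addEdge : ∀ {n} → Rel (Fin n) 0ℓ → Fin n → Fin n → Rel (Fin n) 0ℓ
addEdge E a b x y = E x y ⊎ (x ≡ a × y ≡ b) ⊎ (x ≡ b × y ≡ a)

module _ {n} {E : Rel (Fin n) 0ℓ} where

  edge⇒≢ : (∀ {x} → ¬ E x x) → ∀ {x y} → E x y → y ≢ x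
  edge⇒≢ irr e refl = irr e

  addEdge-sym : Symmetric E → ∀ {a b} → Symmetric (addEdge E a b)
  addEdge-sym E-sym (inj₁ e)                   = inj₁ (E-sym e)
  addEdge-sym E-sym (inj₂ (inj₁ (x≡a , y≡b))) = inj₂ (inj₂ (y≡b , x≡a))
  addEdge-sym E-sym (inj₂ (inj₂ (x≡b , y≡a))) = inj₂ (inj₁ (y≡a , x≡b))

  addEdge-irrefl : (∀ {x} → ¬ E x x) → ∀ {a b x} → a ≢ b → ¬ addEdge E a b x x
  addEdge-irrefl irr a≢b (inj₁ e)                   = irr e
  addEdge-irrefl irr a≢b (inj₂ (inj₁ (x≡a , x≡b))) = a≢b (trans (sym x≡a) x≡b)
  addEdge-irrefl irr a≢b (inj₂ (inj₂ (x≡b , x≡a))) = a≢b (trans (sym x≡a) x≡b)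

  addEdge-comm : ∀ {a b x y} → addEdge E a b x y → addEdge E b a x y
  addEdge-comm (inj₁ e)    = inj₁ e
  addEdge-comm (inj₂ pair) = inj₂ (Sum.swap pair)

  flip-edge⇔ : Symmetric E → ∀ {σ : Fin n → Fin n} {x y} →
    E x y ⇔ (y ≡ σ x ⊎ x ≡ σ y) → E y x ⇔ (x ≡ σ y ⊎ y ≡ σ x)
  flip-edge⇔ E-sym h = mk⇔ (Sum.swap ∘ to h ∘ E-sym) (E-sym ∘ from h ∘ Sum.swap)

module _ {n} {E : Rel (Fin n) 0ℓ} {S : Subset n} where

  swap-neighbours : ∀ {x a b} → NeighboursIn E S x a b → NeighboursIn E S x b a
  swap-neighbours N = record
    { distinct = distinct N ∘ sym ; a∈S = b∈S N ; b∈S = a∈S N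
    ; edge-a = edge-b N ; edge-b = edge-a N ; only = λ y∈S e → Sum.swap (only N y∈S e) }

  other-neighbour : ∀ {x a b y} → NeighboursIn E S x a b → y ∈ S → E x y → ∃ (NeighboursIn E S x y)
  other-neighbour N y∈S e with only N y∈S e
  ... | inj₁ refl = _ , N
  ... | inj₂ refl = _ , swap-neighbours N

  adjacent? : ∀ {x a b y} → NeighboursIn E S x a b → y ∈ S → Dec (E x y)
  adjacent? {a = a} {b} {y} N y∈S with y ≟ a | y ≟ b
  ... | yes refl | _        = yes (edge-a N)
  ... | no _     | yes refl = yes (edge-b N)
  ... | no y≢a   | no y≢b   = no λ e → [ y≢a , y≢b ] (only N y∈S e)

  non-neighbour : Symmetric E → ∀ {u a b x} → NeighboursIn E S u a b →
    x ∈ S → x ≢ a → x ≢ b → ¬ E x u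
  non-neighbour E-sym N x∈S x≢a x≢b e = [ x≢a , x≢b ] (only N x∈S (E-sym e))

  triangle-neighbours : Symmetric E → (∀ {x} → ¬ E x x) → TwoRegular E S →
    ∀ {v a b} → v ∈ S → NeighboursIn E S v a b → E a b → NeighboursIn E S a v b
  triangle-neighbours E-sym irr reg v∈S nv ab
    with other-neighbour (proj₂ (proj₂ (reg (a∈S nv)))) v∈S (E-sym (edge-a nv))
  ... | c , na with only na (b∈S nv) ab
  ...   | inj₁ refl = ⊥-elim (irr (edge-b nv))
  ...   | inj₂ refl = na

  TwoRegular-restrict : TwoRegular E S → ∀ {S′} → S′ ⊆ S →
    (∀ {x y} → x ∈ S′ → y ∈ S → E x y → y ∈ S′) → TwoRegular E S′
  TwoRegular-restrict reg S′⊆S stays x∈S′ with reg (S′⊆S x∈S′)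
  ... | a , b , N = a , b , record
    { distinct = distinct N
    ; a∈S      = stays x∈S′ (a∈S N) (edge-a N)
    ; b∈S      = stays x∈S′ (b∈S N) (edge-b N)
    ; edge-a   = edge-a N
    ; edge-b   = edge-b N
    ; only     = only N ∘ S′⊆S }

module _ {n} {E : Rel (Fin n) 0ℓ} {S : Subset n} {σ : Fin n → Fin n} where

  empty-orientation : Empty S → Orientation E S σ
  empty-orientation empty = record
    { closed    = λ {x} x∈S → ⊥-elim (empty (x , x∈S))
    ; injective = λ {x} x∈S → ⊥-elim (empty (x , x∈S))
    ; edge⇔     = λ {x} x∈S → ⊥-elim (empty (x , x∈S)) }

  orientation-cong : ∀ {F : Rel (Fin n) 0ℓ} →
    (∀ {x y} → E x y → F x y) → (∀ {x y} → F x y → E x y) → Orientation E S σ → Orientation F S σ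
  orientation-cong E⇒F F⇒E or = record
    { closed    = closed or
    ; injective = injective or
    ; edge⇔     = λ x∈S y∈S → mk⇔ (to (edge⇔ or x∈S y∈S) ∘ F⇒E) (E⇒F ∘ from (edge⇔ or x∈S y∈S)) }

  σ-no-fixpoint : (∀ {x} → ¬ E x x) → Orientation E S σ → ∀ {x} → x ∈ S → σ x ≢ x
  σ-no-fixpoint irr or x∈S = edge⇒≢ {E = E} irr (from (edge⇔ or x∈S (closed or x∈S)) (inj₁ refl))

  σ∘σ-no-fixpoint : Orientation E S σ → ∀ {x a b} → NeighboursIn E S x a b → x ∈ S → σ (σ x) ≢ x
  σ∘σ-no-fixpoint or {x} N x∈S σσx≡x =
    distinct N (trans (is-σx (a∈S N) (edge-a N)) (sym (is-σx (b∈S N) (edge-b N))))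
    where
      is-σx : ∀ {y} → y ∈ S → E x y → y ≡ σ x
      is-σx y∈S e with to (edge⇔ or x∈S y∈S) e
      ... | inj₁ y≡σx = y≡σx
      ... | inj₂ x≡σy = injective or y∈S (closed or x∈S) (trans (sym x≡σy) (sym σσx≡x))

  edge⇔-at : ∀ {x p q} → NeighboursIn E S x p q → σ p ≡ x → σ x ≡ q →
    (∀ {y} → y ∈ S → σ y ≡ x → y ≡ p) → ∀ {y} → y ∈ S → E x y ⇔ (y ≡ σ x ⊎ x ≡ σ y)
  edge⇔-at {x} N σp≡x σx≡q pred {y} y∈S = mk⇔ forward backward
    where
      forward : E x y → y ≡ σ x ⊎ x ≡ σ y
      forward e with only N y∈S e
      ... | inj₁ refl = inj₂ (sym σp≡x)
      ... | inj₂ refl = inj₁ (sym σx≡q)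
      backward : y ≡ σ x ⊎ x ≡ σ y → E x y
      backward (inj₁ y≡σx) = subst (E x) (sym (trans y≡σx σx≡q)) (edge-b N)
      backward (inj₂ x≡σy) = subst (E x) (sym (pred y∈S (sym x≡σy))) (edge-a N)

module PathCase {n} {E : Rel (Fin n) 0ℓ} (E-sym : Symmetric E) (irr : ∀ {x} → ¬ E x x)
  {S : Subset n} {v a b : Fin n} (v∈S : v ∈ S) (nv : NeighboursIn E S v a b) (¬ab : ¬ E a b) where

  a≢v : a ≢ v
  a≢v = edge⇒≢ {E = E} irr (edge-a nv)

  b≢v : b ≢ v
  b≢v = edge⇒≢ {E = E} irr (edge-b nv)

  a∈S-v : a ∈ S - v
  a∈S-v = x∈p∧x≢y⇒x∈p-y (a∈S nv) a≢v

  b∈S-v : b ∈ S - v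
  b∈S-v = x∈p∧x≢y⇒x∈p-y (b∈S nv) b≢v

  endpoint-neighbours : TwoRegular E S → ∀ {u w} → NeighboursIn E S v u w → ¬ E u w →
    ∀ {F : Rel (Fin n) 0ℓ} → (∀ {y} → F u y ⇔ (E u y ⊎ y ≡ w)) →
    ∃ λ c → NeighboursIn F (S - v) u c w
  endpoint-neighbours reg {u} {w} nu ¬uw row
    with other-neighbour (proj₂ (proj₂ (reg (a∈S nu)))) v∈S (E-sym (edge-a nu))
  ... | c , N = c , record
    { distinct = λ { refl → ¬uw (edge-b N) }
    ; a∈S      = x∈p∧x≢y⇒x∈p-y (b∈S N) (distinct N ∘ sym)
    ; b∈S      = x∈p∧x≢y⇒x∈p-y (b∈S nu) (edge⇒≢ {E = E} irr (edge-b nu))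
    ; edge-a   = from row (inj₁ (edge-b N))
    ; edge-b   = from row (inj₂ refl)
    ; only     = λ y∈S-v e → only′ (x∈p-y⁻ y∈S-v) (to row e) }
    where
      only′ : ∀ {y} → y ∈ S × y ≢ v → E u y ⊎ y ≡ w → y ≡ c ⊎ y ≡ w
      only′ _ (inj₂ y≡w) = inj₂ y≡w
      only′ (y∈S , y≢v) (inj₁ e) with only N y∈S e
      ... | inj₁ y≡v = ⊥-elim (y≢v y≡v)
      ... | inj₂ y≡c = inj₁ y≡c

  row-a : ∀ {y} → addEdge E a b a y ⇔ (E a y ⊎ y ≡ b)
  row-a = mk⇔ (λ { (inj₁ e) → inj₁ e ; (inj₂ (inj₁ (_ , y≡b))) → inj₂ y≡b
                 ; (inj₂ (inj₂ (a≡b , _))) → ⊥-elim (distinct nv a≡b) })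
              [ inj₁ , (λ y≡b → inj₂ (inj₁ (refl , y≡b))) ]

  row-b : ∀ {y} → addEdge E a b b y ⇔ (E b y ⊎ y ≡ a)
  row-b = mk⇔ (λ { (inj₁ e) → inj₁ e ; (inj₂ (inj₁ (b≡a , _))) → ⊥-elim (distinct nv (sym b≡a))
                 ; (inj₂ (inj₂ (_ , y≡a))) → inj₂ y≡a })
              [ inj₁ , (λ y≡a → inj₂ (inj₂ (refl , y≡a))) ]

  regular : TwoRegular E S → TwoRegular (addEdge E a b) (S - v)
  regular reg {x} x∈S-v with x ≟ a | x ≟ b
  ... | yes refl | _ =
    let c , N = endpoint-neighbours reg nv ¬ab row-a in c , b , N
  ... | no _ | yes refl =
    let c , N = endpoint-neighbours reg (swap-neighbours nv) (¬ab ∘ E-sym) row-b in c , a , N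
  ... | no x≢a | no x≢b with x∈p-y⁻ x∈S-v
  ...   | x∈S , _ with reg x∈S
  ...     | p , q , N = p , q , record
    { distinct = distinct N
    ; a∈S      = stays (a∈S N) (edge-a N)
    ; b∈S      = stays (b∈S N) (edge-b N)
    ; edge-a   = inj₁ (edge-a N)
    ; edge-b   = inj₁ (edge-b N)
    ; only     = λ y∈S-v → [ only N (proj₁ (x∈p-y⁻ y∈S-v)) , new-edge ] }
    where
      stays : ∀ {y} → y ∈ S → E x y → y ∈ S - v
      stays y∈S e = x∈p∧x≢y⇒x∈p-y y∈S λ { refl → non-neighbour E-sym nv x∈S x≢a x≢b e }
      new-edge : ∀ {y} → (x ≡ a × y ≡ b) ⊎ (x ≡ b × y ≡ a) → y ≡ p ⊎ y ≡ q
      new-edge (inj₁ (x≡a , _)) = ⊥-elim (x≢a x≡a)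
      new-edge (inj₂ (x≡b , _)) = ⊥-elim (x≢b x≡b)

  module Insert {σ′ : Fin n → Fin n} (or′ : Orientation (addEdge E a b) (S - v) σ′)
    (σ′a≡b : σ′ a ≡ b) (σ′b≢a : σ′ b ≢ a) where

    σ : Fin n → Fin n
    σ x with x ≟ a | x ≟ v
    ... | yes _ | _     = v
    ... | no _  | yes _ = b
    ... | no _  | no _  = σ′ x

    σ-a : σ a ≡ v
    σ-a with a ≟ a
    ... | yes _  = refl
    ... | no a≢a = ⊥-elim (a≢a refl)

    σ-v : σ v ≡ b
    σ-v with v ≟ a | v ≟ v
    ... | yes v≡a | _      = ⊥-elim (a≢v (sym v≡a))
    ... | no _    | yes _  = refl
    ... | no _    | no v≢v = ⊥-elim (v≢v refl)

    σ-elsewhere : ∀ {x} → x ∈ S - v → x ≢ a → σ x ≡ σ′ x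
    σ-elsewhere {x} x∈S-v x≢a with x ≟ a | x ≟ v
    ... | yes x≡a | _       = ⊥-elim (x≢a x≡a)
    ... | no _    | yes x≡v = ⊥-elim (proj₂ (x∈p-y⁻ x∈S-v) x≡v)
    ... | no _    | no _    = refl

    data Position : Fin n → Set where
      at-v      : Position v
      at-a      : Position a
      elsewhere : ∀ {x} → x ∈ S - v → x ≢ a → Position x

    position : ∀ {x} → x ∈ S → Position x
    position {x} x∈S with x ≟ v | x ≟ a
    ... | yes refl | _        = at-v
    ... | no _     | yes refl = at-a
    ... | no x≢v   | no x≢a   = elsewhere (x∈p∧x≢y⇒x∈p-y x∈S x≢v) x≢a

    pred-v : ∀ {y} → y ∈ S → σ y ≡ v → y ≡ a
    pred-v y∈S σy≡v with position y∈S
    ... | at-v = ⊥-elim (b≢v (trans (sym σ-v) σy≡v))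
    ... | at-a = refl
    ... | elsewhere y∈S-v y≢a =
      ⊥-elim (proj₂ (x∈p-y⁻ (closed or′ y∈S-v)) (trans (sym (σ-elsewhere y∈S-v y≢a)) σy≡v))

    pred-b : ∀ {y} → y ∈ S → σ y ≡ b → y ≡ v
    pred-b y∈S σy≡b with position y∈S
    ... | at-v = refl
    ... | at-a = ⊥-elim (b≢v (trans (sym σy≡b) σ-a))
    ... | elsewhere y∈S-v y≢a = ⊥-elim (y≢a (injective or′ y∈S-v a∈S-v
      (trans (sym (σ-elsewhere y∈S-v y≢a)) (trans σy≡b (sym σ′a≡b)))))

    edge⇔-a : ∀ {y} → y ∈ S - v → E a y ⇔ (y ≡ σ a ⊎ a ≡ σ y)
    edge⇔-a {y} y∈S-v = mk⇔ forward backward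
      where
        y≢v : y ≢ v
        y≢v = proj₂ (x∈p-y⁻ y∈S-v)
        forward : E a y → y ≡ σ a ⊎ a ≡ σ y
        forward e with to (edge⇔ or′ a∈S-v y∈S-v) (inj₁ e)
        ... | inj₁ y≡σ′a = ⊥-elim (¬ab (subst (E a) (trans y≡σ′a σ′a≡b) e))
        ... | inj₂ a≡σ′y = inj₂ (trans a≡σ′y (sym (σ-elsewhere y∈S-v y≢a)))
          where
            y≢a : y ≢ a
            y≢a refl = distinct nv (trans a≡σ′y σ′a≡b)
        backward : y ≡ σ a ⊎ a ≡ σ y → E a y
        backward (inj₁ y≡σa) = ⊥-elim (y≢v (trans y≡σa σ-a))
        backward (inj₂ a≡σy) with position (proj₁ (x∈p-y⁻ y∈S-v))
        ... | at-v = ⊥-elim (y≢v refl)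
        ... | at-a = ⊥-elim (a≢v (trans a≡σy σ-a))
        ... | elsewhere _ y≢a
          with from (edge⇔ or′ a∈S-v y∈S-v) (inj₂ (trans a≡σy (σ-elsewhere y∈S-v y≢a)))
        ...   | inj₁ e                  = e
        ...   | inj₂ (inj₁ (_ , refl))  = ⊥-elim (σ′b≢a (sym (trans a≡σy (σ-elsewhere y∈S-v y≢a))))
        ...   | inj₂ (inj₂ (a≡b , _))   = ⊥-elim (distinct nv a≡b)

    orientation : Orientation E S σ
    orientation = record { closed = closed′ ; injective = injective′ ; edge⇔ = edge⇔′ }
      where
        closed′ : ∀ {x} → x ∈ S → σ x ∈ S
        closed′ x∈S with position x∈S
        ... | at-v = subst (_∈ S) (sym σ-v) (b∈S nv)
        ... | at-a = subst (_∈ S) (sym σ-a) v∈S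
        ... | elsewhere x∈S-v x≢a =
          subst (_∈ S) (sym (σ-elsewhere x∈S-v x≢a)) (proj₁ (x∈p-y⁻ (closed or′ x∈S-v)))

        injective′ : ∀ {x y} → x ∈ S → y ∈ S → σ x ≡ σ y → x ≡ y
        injective′ x∈S y∈S σx≡σy with position x∈S | position y∈S
        ... | _    | at-v          = pred-b x∈S (trans σx≡σy σ-v)
        ... | _    | at-a          = pred-v x∈S (trans σx≡σy σ-a)
        ... | at-v | elsewhere _ _ = sym (pred-b y∈S (trans (sym σx≡σy) σ-v))
        ... | at-a | elsewhere _ _ = sym (pred-v y∈S (trans (sym σx≡σy) σ-a))
        ... | elsewhere x∈S-v x≢a | elsewhere y∈S-v y≢a = injective or′ x∈S-v y∈S-v
          (trans (sym (σ-elsewhere x∈S-v x≢a)) (trans σx≡σy (σ-elsewhere y∈S-v y≢a)))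

        edge⇔′ : ∀ {x y} → x ∈ S → y ∈ S → E x y ⇔ (y ≡ σ x ⊎ x ≡ σ y)
        edge⇔′ x∈S y∈S with position x∈S | position y∈S
        ... | at-v | _                    = edge⇔-at nv σ-a σ-v pred-v y∈S
        ... | _    | at-v                 = flip-edge⇔ E-sym (edge⇔-at nv σ-a σ-v pred-v x∈S)
        ... | at-a | at-a                 = edge⇔-a a∈S-v
        ... | at-a | elsewhere y∈S-v _    = edge⇔-a y∈S-v
        ... | elsewhere x∈S-v _ | at-a    = flip-edge⇔ E-sym (edge⇔-a x∈S-v)
        ... | elsewhere x∈S-v x≢a | elsewhere y∈S-v y≢a
          rewrite σ-elsewhere x∈S-v x≢a | σ-elsewhere y∈S-v y≢a =
          mk⇔ (to (edge⇔ or′ x∈S-v y∈S-v) ∘ inj₁) (old-edge ∘ from (edge⇔ or′ x∈S-v y∈S-v))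
          where
            old-edge : addEdge E a b _ _ → E _ _
            old-edge (inj₁ e)                 = e
            old-edge (inj₂ (inj₁ (x≡a , _))) = ⊥-elim (x≢a x≡a)
            old-edge (inj₂ (inj₂ (_ , y≡a))) = ⊥-elim (y≢a y≡a)

path-orientation : ∀ {n} {E : Rel (Fin n) 0ℓ} (E-sym : Symmetric E) (irr : ∀ {x} → ¬ E x x)
  {S : Subset n} {v a b : Fin n} (v∈S : v ∈ S) (nv : NeighboursIn E S v a b) (¬ab : ¬ E a b) →
  TwoRegular E S → ∀ {σ′} → Orientation (addEdge E a b) (S - v) σ′ → ∃ (Orientation E S)
path-orientation {E = E} E-sym irr {S} {v} {a} {b} v∈S nv ¬ab reg {σ′} or′ =
  orient (to (edge⇔ or′ a∈S-v b∈S-v) (inj₂ (inj₁ (refl , refl))))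
  where
    open PathCase E-sym irr v∈S nv ¬ab
    module Swapped = PathCase E-sym irr v∈S (swap-neighbours nv) (¬ab ∘ E-sym)

    no-2-cycle : σ′ (σ′ a) ≢ a
    no-2-cycle = σ∘σ-no-fixpoint or′ (proj₂ (proj₂ (regular reg a∈S-v))) a∈S-v

    orient : b ≡ σ′ a ⊎ a ≡ σ′ b → ∃ (Orientation E S)
    orient (inj₁ b≡σ′a) = _ , Insert.orientation or′ (sym b≡σ′a)
      (λ σ′b≡a → no-2-cycle (trans (cong σ′ (sym b≡σ′a)) σ′b≡a))
    orient (inj₂ a≡σ′b) = _ , Swapped.Insert.orientation
      (orientation-cong (addEdge-comm {E = E}) (addEdge-comm {E = E}) or′) (sym a≡σ′b)
      (λ σ′a≡b → no-2-cycle (trans (cong σ′ σ′a≡b) (sym a≡σ′b)))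

module TriangleCase {n} {E : Rel (Fin n) 0ℓ} (E-sym : Symmetric E) (irr : ∀ {x} → ¬ E x x)
  {S : Subset n} (reg : TwoRegular E S) {v a b : Fin n} (v∈S : v ∈ S)
  (nv : NeighboursIn E S v a b) (ab : E a b) where

  na : NeighboursIn E S a v b
  na = triangle-neighbours E-sym irr reg v∈S nv ab

  nb : NeighboursIn E S b v a
  nb = triangle-neighbours E-sym irr reg v∈S (swap-neighbours nv) (E-sym ab)

  rest : Subset n
  rest = S - v - a - b

  rest⁻ : ∀ {x} → x ∈ rest → x ∈ S × x ≢ v × x ≢ a × x ≢ b
  rest⁻ x∈rest with x∈p-y⁻ x∈rest
  ... | x∈S-v-a , x≢b with x∈p-y⁻ x∈S-v-a
  ...   | x∈S-v , x≢a = proj₁ (x∈p-y⁻ x∈S-v) , proj₂ (x∈p-y⁻ x∈S-v) , x≢a , x≢b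

  rest⁺ : ∀ {x} → x ∈ S → x ≢ v → x ≢ a → x ≢ b → x ∈ rest
  rest⁺ x∈S x≢v x≢a x≢b = x∈p∧x≢y⇒x∈p-y (x∈p∧x≢y⇒x∈p-y (x∈p∧x≢y⇒x∈p-y x∈S x≢v) x≢a) x≢b

  ∣rest∣<∣S∣ : ∣ rest ∣ < ∣ S ∣
  ∣rest∣<∣S∣ = ≤-<-trans (≤-trans (∣p─q∣≤∣p∣ (S - v - a) ⁅ b ⁆) (∣p─q∣≤∣p∣ (S - v) ⁅ a ⁆))
                         (x∈p⇒∣p-x∣<∣p∣ v∈S)

  regular : TwoRegular E rest
  regular = TwoRegular-restrict reg (proj₁ ∘ rest⁻) stays
    where
      stays : ∀ {x y} → x ∈ rest → y ∈ S → E x y → y ∈ rest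
      stays x∈rest y∈S e with rest⁻ x∈rest
      ... | x∈S , x≢v , x≢a , x≢b = rest⁺ y∈S
        (λ { refl → non-neighbour E-sym nv x∈S x≢a x≢b e })
        (λ { refl → non-neighbour E-sym na x∈S x≢v x≢b e })
        (λ { refl → non-neighbour E-sym nb x∈S x≢v x≢a e })

  module Extend {σ″ : Fin n → Fin n} (or″ : Orientation E rest σ″) where

    a≢v : a ≢ v
    a≢v = edge⇒≢ {E = E} irr (edge-a nv)

    b≢v : b ≢ v
    b≢v = edge⇒≢ {E = E} irr (edge-b nv)

    σ : Fin n → Fin n
    σ x with x ≟ v | x ≟ a | x ≟ b
    ... | yes _ | _     | _     = a
    ... | no _  | yes _ | _     = b
    ... | no _  | no _  | yes _ = v
    ... | no _  | no _  | no _  = σ″ x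

    σ-v : σ v ≡ a
    σ-v with v ≟ v
    ... | yes _  = refl
    ... | no v≢v = ⊥-elim (v≢v refl)

    σ-a : σ a ≡ b
    σ-a with a ≟ v | a ≟ a
    ... | yes a≡v | _      = ⊥-elim (a≢v a≡v)
    ... | no _    | yes _  = refl
    ... | no _    | no a≢a = ⊥-elim (a≢a refl)

    σ-b : σ b ≡ v
    σ-b with b ≟ v | b ≟ a | b ≟ b
    ... | yes b≡v | _       | _      = ⊥-elim (b≢v b≡v)
    ... | no _    | yes b≡a | _      = ⊥-elim (distinct nv (sym b≡a))
    ... | no _    | no _    | yes _  = refl
    ... | no _    | no _    | no b≢b = ⊥-elim (b≢b refl)

    σ-rest : ∀ {x} → x ∈ rest → σ x ≡ σ″ x
    σ-rest {x} x∈rest with rest⁻ x∈rest | x ≟ v | x ≟ a | x ≟ b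
    ... | _ , x≢v , _ , _ | yes x≡v | _       | _       = ⊥-elim (x≢v x≡v)
    ... | _ , _ , x≢a , _ | no _    | yes x≡a | _       = ⊥-elim (x≢a x≡a)
    ... | _ , _ , _ , x≢b | no _    | no _    | yes x≡b = ⊥-elim (x≢b x≡b)
    ... | _               | no _    | no _    | no _    = refl

    σ-rest∈rest : ∀ {x} → x ∈ rest → σ x ∈ rest
    σ-rest∈rest x∈rest = subst (_∈ rest) (sym (σ-rest x∈rest)) (closed or″ x∈rest)

    data Position : Fin n → Set where
      at-v      : Position v
      at-a      : Position a
      at-b      : Position b
      elsewhere : ∀ {x} → x ∈ rest → Position x

    position : ∀ {x} → x ∈ S → Position x
    position {x} x∈S with x ≟ v | x ≟ a | x ≟ b
    ... | yes refl | _        | _        = at-v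
    ... | no _     | yes refl | _        = at-a
    ... | no _     | no _     | yes refl = at-b
    ... | no x≢v   | no x≢a   | no x≢b   = elsewhere (rest⁺ x∈S x≢v x≢a x≢b)

    pred-v : ∀ {y} → y ∈ S → σ y ≡ v → y ≡ b
    pred-v y∈S σy≡v with position y∈S
    ... | at-v = ⊥-elim (a≢v (trans (sym σ-v) σy≡v))
    ... | at-a = ⊥-elim (b≢v (trans (sym σ-a) σy≡v))
    ... | at-b = refl
    ... | elsewhere y∈rest = ⊥-elim (proj₁ (proj₂ (rest⁻ (σ-rest∈rest y∈rest))) σy≡v)

    pred-a : ∀ {y} → y ∈ S → σ y ≡ a → y ≡ v
    pred-a y∈S σy≡a with position y∈S
    ... | at-v = refl
    ... | at-a = ⊥-elim (distinct nv (trans (sym σy≡a) σ-a))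
    ... | at-b = ⊥-elim (a≢v (trans (sym σy≡a) σ-b))
    ... | elsewhere y∈rest = ⊥-elim (proj₁ (proj₂ (proj₂ (rest⁻ (σ-rest∈rest y∈rest)))) σy≡a)

    pred-b : ∀ {y} → y ∈ S → σ y ≡ b → y ≡ a
    pred-b y∈S σy≡b with position y∈S
    ... | at-v = ⊥-elim (distinct nv (trans (sym σ-v) σy≡b))
    ... | at-a = refl
    ... | at-b = ⊥-elim (b≢v (trans (sym σy≡b) σ-b))
    ... | elsewhere y∈rest = ⊥-elim (proj₂ (proj₂ (proj₂ (rest⁻ (σ-rest∈rest y∈rest)))) σy≡b)

    edge⇔-v : ∀ {y} → y ∈ S → E v y ⇔ (y ≡ σ v ⊎ v ≡ σ y)
    edge⇔-v = edge⇔-at (swap-neighbours nv) σ-b σ-v pred-v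

    edge⇔-a : ∀ {y} → y ∈ S → E a y ⇔ (y ≡ σ a ⊎ a ≡ σ y)
    edge⇔-a = edge⇔-at na σ-v σ-a pred-a

    edge⇔-b : ∀ {y} → y ∈ S → E b y ⇔ (y ≡ σ b ⊎ b ≡ σ y)
    edge⇔-b = edge⇔-at (swap-neighbours nb) σ-a σ-b pred-b

    orientation : Orientation E S σ
    orientation = record { closed = closed′ ; injective = injective′ ; edge⇔ = edge⇔′ }
      where
        closed′ : ∀ {x} → x ∈ S → σ x ∈ S
        closed′ x∈S with position x∈S
        ... | at-v             = subst (_∈ S) (sym σ-v) (a∈S nv)
        ... | at-a             = subst (_∈ S) (sym σ-a) (b∈S nv)
        ... | at-b             = subst (_∈ S) (sym σ-b) v∈S
        ... | elsewhere x∈rest = proj₁ (rest⁻ (σ-rest∈rest x∈rest))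

        injective′ : ∀ {x y} → x ∈ S → y ∈ S → σ x ≡ σ y → x ≡ y
        injective′ x∈S y∈S σx≡σy with position x∈S | position y∈S
        ... | _    | at-v        = pred-a x∈S (trans σx≡σy σ-v)
        ... | _    | at-a        = pred-b x∈S (trans σx≡σy σ-a)
        ... | _    | at-b        = pred-v x∈S (trans σx≡σy σ-b)
        ... | at-v | elsewhere _ = sym (pred-a y∈S (trans (sym σx≡σy) σ-v))
        ... | at-a | elsewhere _ = sym (pred-b y∈S (trans (sym σx≡σy) σ-a))
        ... | at-b | elsewhere _ = sym (pred-v y∈S (trans (sym σx≡σy) σ-b))
        ... | elsewhere x∈rest | elsewhere y∈rest = injective or″ x∈rest y∈rest
          (trans (sym (σ-rest x∈rest)) (trans σx≡σy (σ-rest y∈rest)))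

        edge⇔′ : ∀ {x y} → x ∈ S → y ∈ S → E x y ⇔ (y ≡ σ x ⊎ x ≡ σ y)
        edge⇔′ x∈S y∈S with position x∈S | position y∈S
        ... | at-v        | _    = edge⇔-v y∈S
        ... | at-a        | _    = edge⇔-a y∈S
        ... | at-b        | _    = edge⇔-b y∈S
        ... | elsewhere _ | at-v = flip-edge⇔ E-sym (edge⇔-v x∈S)
        ... | elsewhere _ | at-a = flip-edge⇔ E-sym (edge⇔-a x∈S)
        ... | elsewhere _ | at-b = flip-edge⇔ E-sym (edge⇔-b x∈S)
        ... | elsewhere x∈rest | elsewhere y∈rest
          rewrite σ-rest x∈rest | σ-rest y∈rest = edge⇔ or″ x∈rest y∈rest

orientation : ∀ {n} {E : Rel (Fin n) 0ℓ} → Symmetric E → (∀ {x} → ¬ E x x) →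
  (S : Subset n) → Acc _<_ ∣ S ∣ → TwoRegular E S → ∃ (Orientation E S)
orientation {E = E} E-sym irr S (acc smaller) reg with nonempty? S
... | no empty = id , empty-orientation empty
... | yes (v , v∈S) with reg v∈S
...   | a , b , nv with adjacent? (proj₂ (proj₂ (reg (a∈S nv)))) (b∈S nv)
...     | yes ab =
  let open TriangleCase E-sym irr reg v∈S nv ab
      _ , or″ = orientation E-sym irr rest (smaller ∣rest∣<∣S∣) regular
  in _ , Extend.orientation or″
...     | no ¬ab =
  let open PathCase E-sym irr v∈S nv ¬ab
      _ , or′ = orientation (addEdge-sym E-sym) (addEdge-irrefl {E = E} irr (distinct nv)) (S - v)
                  (smaller (x∈p⇒∣p-x∣<∣p∣ v∈S)) (regular reg)
  in path-orientation E-sym irr v∈S nv ¬ab reg or′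

module _ {n} (G : SimpleGraph n) where
  open SimpleGraph G using (adj)

  Adj-sym : Symmetric (Adj G)
  Adj-sym {x} {y} e = trans (SimpleGraph.sym G y x) e

  Adj-irrefl : ∀ {x} → ¬ Adj G x x
  Adj-irrefl {x} e with () ← trans (sym (SimpleGraph.irrefl G x)) e

  lookup-N : ∀ x z → lookup (N G x) z ≡ adj x z
  lookup-N x = lookup∘tabulate (adj x)

  lookup-N∩N : ∀ x y z → lookup (N G x ∩ N G y) z ≡ adj x z ∧ adj y z
  lookup-N∩N x y z = trans (lookup-∩ (N G x) (N G y) z) (cong₂ _∧_ (lookup-N x z) (lookup-N y z))

  ∈N⇔Adj : ∀ {x y} → y ∈ N G x ⇔ Adj G x y
  ∈N⇔Adj {x} {y} = mk⇔ (trans (sym (lookup-N x y)) ∘ ∈⇒lookup≡true)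
                       (lookup≡true⇒∈ ∘ trans (lookup-N x y))

  regular⇒TwoRegular : ∀ {S} → IsRegularOn G S 2 → TwoRegular (Adj G) S
  regular⇒TwoRegular regular {x} x∈S with ∣p∣≡2⇒pair (regular x x∈S)
  ... | a , b , a≢b , a∈ , b∈ , only = a , b , record
    { distinct = a≢b
    ; a∈S      = proj₂ (x∈p∩q⁻ _ _ a∈)
    ; b∈S      = proj₂ (x∈p∩q⁻ _ _ b∈)
    ; edge-a   = to ∈N⇔Adj (proj₁ (x∈p∩q⁻ _ _ a∈))
    ; edge-b   = to ∈N⇔Adj (proj₁ (x∈p∩q⁻ _ _ b∈))
    ; only     = λ y∈S e → only (x∈p∩q⁺ (from ∈N⇔Adj e , y∈S)) }

  regular⇒cycles : ∀ S → IsRegularOn G S 2 → IsDisjointUnionOfCycles G S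
  regular⇒cycles S regular =
    let σ , or = orientation Adj-sym Adj-irrefl S (<-wellFounded ∣ S ∣) (regular⇒TwoRegular regular)
    in σ , (λ _ → closed or)
         , (λ _ _ → injective or)
         , (λ _ → σ-no-fixpoint Adj-irrefl or)
         , (λ _ x∈S → σ∘σ-no-fixpoint or (proj₂ (proj₂ (regular⇒TwoRegular regular x∈S))) x∈S)
         , (λ _ _ → edge⇔ or)

  clique-vertex : ∀ {K z} → IsClique G K → z ∈ K → N G z ∩ K ≡ K - z
  clique-vertex {K} {z} clique z∈K = ⊆-antisym ⊆K-z K-z⊆
    where
      ⊆K-z : N G z ∩ K ⊆ K - z
      ⊆K-z y∈ with x∈p∩q⁻ _ _ y∈
      ... | y∈N , y∈K = x∈p∧x≢y⇒x∈p-y y∈K λ { refl → Adj-irrefl (to ∈N⇔Adj y∈N) }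
      K-z⊆ : K - z ⊆ N G z ∩ K
      K-z⊆ y∈ with x∈p-y⁻ {p = K} y∈
      ... | y∈K , y≢z = x∈p∩q⁺ (from ∈N⇔Adj (clique z _ z∈K y∈K (y≢z ∘ sym)) , y∈K)

  clique-extend : ∀ {s K z} → IsClique-of-size G s K → z ∉ K → K ⊆ N G z →
    IsClique-of-size G (suc s) (K ∪ ⁅ z ⁆)
  clique-extend {s} {K} {z} (clique , ∣K∣≡s) z∉K K⊆Nz = clique′ , size
    where
      adjacent-to-z : ∀ {x} → x ∈ K → Adj G z x
      adjacent-to-z = to ∈N⇔Adj ∘ K⊆Nz
      clique′ : IsClique G (K ∪ ⁅ z ⁆)
      clique′ x y x∈ y∈ x≢y with x∈p∪q⁻ K ⁅ z ⁆ x∈ | x∈p∪q⁻ K ⁅ z ⁆ y∈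
      ... | inj₁ x∈K | inj₁ y∈K = clique x y x∈K y∈K x≢y
      ... | inj₁ x∈K | inj₂ y∈z rewrite x∈⁅y⁆⇒x≡y z y∈z = Adj-sym (adjacent-to-z x∈K)
      ... | inj₂ x∈z | inj₁ y∈K rewrite x∈⁅y⁆⇒x≡y z x∈z = adjacent-to-z y∈K
      ... | inj₂ x∈z | inj₂ y∈z = ⊥-elim (x≢y (trans (x∈⁅y⁆⇒x≡y z x∈z) (sym (x∈⁅y⁆⇒x≡y z y∈z))))
      size : ∣ K ∪ ⁅ z ⁆ ∣ ≡ suc s
      size = trans (sym (x∈p⇒suc∣p-x∣≡∣p∣ {p = K ∪ ⁅ z ⁆} (x∈p∪q⁺ (inj₂ (x∈⁅x⁆ z)))))
                   (cong suc (trans (cong ∣_∣ (x∉p⇒p∪⁅x⁆-x≡p z∉K)) ∣K∣≡s))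

-- Double counting in strongly regular graphs

module _ {n} (G : SimpleGraph n) where
  open SimpleGraph G using (adj)

  ∑N : Fin n → (Fin n → ℕ) → ℕ
  ∑N x f = sum (λ z → 𝟙 (adj x z) * f z)

  ∑N-cong : ∀ x {f g} → (∀ z → f z ≡ g z) → ∑N x f ≡ ∑N x g
  ∑N-cong x f≗g = sum-cong-≗ λ z → cong (𝟙 (adj x z) *_) (f≗g z)

  ∑N-+ : ∀ x f g → ∑N x (λ z → f z + g z) ≡ ∑N x f + ∑N x g
  ∑N-+ x f g = trans (sum-cong-≗ λ z → *-distribˡ-+ (𝟙 (adj x z)) (f z) (g z))
                     (∑-distrib-+ (λ z → 𝟙 (adj x z) * f z) (λ z → 𝟙 (adj x z) * g z))

  ∑N-+₃ : ∀ x f g h → ∑N x (λ z → f z + g z + h z) ≡ ∑N x f + ∑N x g + ∑N x h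
  ∑N-+₃ x f g h = trans (∑N-+ x (λ z → f z + g z) h) (cong (_+ ∑N x h) (∑N-+ x f g))

  ∑N-* : ∀ x c f → ∑N x (λ z → c * f z) ≡ c * ∑N x f
  ∑N-* x c f = trans (sum-cong-≗ λ z → x∙yz≈y∙xz (𝟙 (adj x z)) c (f z))
                     (sym (*-distribˡ-sum c (λ z → 𝟙 (adj x z) * f z)))

  ∣N∣≡∑ : ∀ x → ∣ N G x ∣ ≡ sum (𝟙 ∘ adj x)
  ∣N∣≡∑ x = trans (∣p∣≡∑ (N G x)) (sum-cong-≗ (cong 𝟙 ∘ lookup-N G x))

  ∣N∣≡∑N : ∀ x → ∣ N G x ∣ ≡ ∑N x (λ _ → 1)
  ∣N∣≡∑N x = trans (∣N∣≡∑ x) (sum-cong-≗ λ z → sym (*-identityʳ (𝟙 (adj x z))))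

  ∣N∩p∣≡∑N : ∀ x p → ∣ N G x ∩ p ∣ ≡ ∑N x (𝟙 ∘ lookup p)
  ∣N∩p∣≡∑N x p = trans (∣p∩q∣≡∑ (N G x) p)
    (sum-cong-≗ λ z → cong (λ b → 𝟙 b * 𝟙 (lookup p z)) (lookup-N G x z))

  ∣N∩N∣≡∑N : ∀ x y → ∣ N G x ∩ N G y ∣ ≡ ∑N x (𝟙 ∘ adj y)
  ∣N∩N∣≡∑N x y = trans (∣N∩p∣≡∑N x (N G y)) (∑N-cong x (cong 𝟙 ∘ lookup-N G y))

  double-count : ∀ x Q →
    sum (λ k → 𝟙 (lookup Q k) * ∣ N G x ∩ N G k ∣) ≡ ∑N x (λ z → ∣ N G z ∩ Q ∣)
  double-count x Q = begin
    sum (λ k → χ k * ∣ N G x ∩ N G k ∣)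
      ≡⟨ sum-cong-≗ (λ k → cong (χ k *_) (∣N∩N∣≡∑N x k)) ⟩
    sum (λ k → χ k * sum (λ z → 𝟙 (adj x z) * 𝟙 (adj k z)))
      ≡⟨ sum-cong-≗ (λ k → *-distribˡ-sum (χ k) (λ z → 𝟙 (adj x z) * 𝟙 (adj k z))) ⟩
    sum (λ k → sum (λ z → χ k * (𝟙 (adj x z) * 𝟙 (adj k z))))
      ≡⟨ ∑-comm (λ k z → χ k * (𝟙 (adj x z) * 𝟙 (adj k z))) ⟩
    sum (λ z → sum (λ k → χ k * (𝟙 (adj x z) * 𝟙 (adj k z))))
      ≡⟨ sum-cong-≗ (λ z → sum-cong-≗ (rearrange z)) ⟩
    sum (λ z → sum (λ k → 𝟙 (adj x z) * (𝟙 (adj z k) * χ k)))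
      ≡⟨ sum-cong-≗ (λ z → *-distribˡ-sum (𝟙 (adj x z)) (λ k → 𝟙 (adj z k) * χ k)) ⟨
    ∑N x (λ z → ∑N z χ)
      ≡⟨ ∑N-cong x (λ z → ∣N∩p∣≡∑N z Q) ⟨
    ∑N x (λ z → ∣ N G z ∩ Q ∣) ∎
    where
      open ≡-Reasoning
      χ : Fin n → ℕ
      χ = 𝟙 ∘ lookup Q
      rearrange : ∀ z k → χ k * (𝟙 (adj x z) * 𝟙 (adj k z)) ≡ 𝟙 (adj x z) * (𝟙 (adj z k) * χ k)
      rearrange z k rewrite SimpleGraph.sym G k z = x∙yz≈y∙zx (χ k) (𝟙 (adj x z)) (𝟙 (adj z k))

module StronglyRegular {n} (G : SimpleGraph n) {k l m : ℕ} (srg : IsSRG G k l m) where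
  open SimpleGraph G using (adj)

  ∣N∣ : ∀ x → ∣ N G x ∣ ≡ k
  ∣N∣ = proj₁ srg

  ∣N∩N∣-adjacent : ∀ {x y} → Adj G x y → ∣ N G x ∩ N G y ∣ ≡ l
  ∣N∩N∣-adjacent {x} {y} xy = proj₁ (proj₂ srg) x y (λ { refl → Adj-irrefl G xy }) xy

  ∣N∩N∣-nonadjacent : ∀ {x y} → x ≢ y → adj x y ≡ false → ∣ N G x ∩ N G y ∣ ≡ m
  ∣N∩N∣-nonadjacent {x} {y} = proj₂ (proj₂ srg) x y

  ∑N-∣N∩Q∣ : ∀ {x} Q → lookup Q x ≡ false →
    ∑N G x (λ z → ∣ N G z ∩ Q ∣) + m * ∣ N G x ∩ Q ∣ ≡ l * ∣ N G x ∩ Q ∣ + m * ∣ Q ∣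
  ∑N-∣N∩Q∣ {x} Q x∉Q = begin
    ∑N G x (λ z → ∣ N G z ∩ Q ∣) + m * ∣ N G x ∩ Q ∣
      ≡⟨ cong₂ _+_ (sym (double-count G x Q)) (cong (m *_) (∣N∩p∣≡∑N G x Q)) ⟩
    sum (λ q → χ q * ∣ N G x ∩ N G q ∣) + m * sum (λ q → a q * χ q)
      ≡⟨ cong (sum (λ q → χ q * ∣ N G x ∩ N G q ∣) +_) (*-distribˡ-sum m (λ q → a q * χ q)) ⟩
    sum (λ q → χ q * ∣ N G x ∩ N G q ∣) + sum (λ q → m * (a q * χ q))
      ≡⟨ ∑-distrib-+ (λ q → χ q * ∣ N G x ∩ N G q ∣) (λ q → m * (a q * χ q)) ⟨
    sum (λ q → χ q * ∣ N G x ∩ N G q ∣ + m * (a q * χ q))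
      ≡⟨ sum-cong-≗ pointwise ⟩
    sum (λ q → l * (a q * χ q) + m * χ q)
      ≡⟨ ∑-distrib-+ (λ q → l * (a q * χ q)) (λ q → m * χ q) ⟩
    sum (λ q → l * (a q * χ q)) + sum (λ q → m * χ q)
      ≡⟨ cong₂ _+_ (*-distribˡ-sum l (λ q → a q * χ q)) (*-distribˡ-sum m χ) ⟨
    l * sum (λ q → a q * χ q) + m * sum χ
      ≡⟨ cong₂ _+_ (cong (l *_) (∣N∩p∣≡∑N G x Q)) (cong (m *_) (∣p∣≡∑ Q)) ⟨
    l * ∣ N G x ∩ Q ∣ + m * ∣ Q ∣ ∎
    where
      open ≡-Reasoning
      χ a : Fin n → ℕ
      χ = 𝟙 ∘ lookup Q
      a = 𝟙 ∘ adj x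
      x≢ : ∀ {q} → lookup Q q ≡ true → x ≢ q
      x≢ q∈Q refl with () ← trans (sym x∉Q) q∈Q
      pointwise : ∀ q → χ q * ∣ N G x ∩ N G q ∣ + m * (a q * χ q) ≡ l * (a q * χ q) + m * χ q
      pointwise q with lookup Q q in q∈Q
      ... | false rewrite *-zeroʳ (a q) | *-zeroʳ l | *-zeroʳ m = refl
      ... | true rewrite *-identityʳ (a q) with adj x q in xq
      ...   | true  rewrite ∣N∩N∣-adjacent xq = cong (_+ m * 1) (*-comm 1 l)
      ...   | false rewrite ∣N∩N∣-nonadjacent (x≢ q∈Q) xq | *-zeroʳ m | *-zeroʳ l =
        trans (+-identityʳ (1 * m)) (*-comm 1 m)

-- Layers around a maximal 4-clique of a (v, 40, 12, 20) strongly regular graph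

count₃ : Bool → Bool → Bool → ℕ
count₃ p q r = 𝟙 p + 𝟙 q + 𝟙 r

pairs₃ : Bool → Bool → Bool → ℕ
pairs₃ p q r = 𝟙 p * 𝟙 q + 𝟙 p * 𝟙 r + 𝟙 q * 𝟙 r

data TwoOrNone : Bool → Bool → Bool → Bool → Set where
  pq   : TwoOrNone true  true  false true
  pr   : TwoOrNone true  false true  true
  qr   : TwoOrNone false true  true  true
  none : TwoOrNone false false false false

4count₃≤3pairs₃+5 : ∀ p q r → 4 * count₃ p q r ≤ 3 * pairs₃ p q r + 5
4count₃≤3pairs₃+5 true  true  true  = m≤m+n 12 2
4count₃≤3pairs₃+5 true  true  false = ≤-refl
4count₃≤3pairs₃+5 true  false true  = ≤-refl
4count₃≤3pairs₃+5 true  false false = m≤m+n 4 1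
4count₃≤3pairs₃+5 false true  true  = ≤-refl
4count₃≤3pairs₃+5 false true  false = m≤m+n 4 1
4count₃≤3pairs₃+5 false false true  = m≤m+n 4 1
4count₃≤3pairs₃+5 false false false = z≤n

4count₃≡3pairs₃+5⇒TwoOrNone : ∀ p q r →
  4 * count₃ p q r ≡ 3 * pairs₃ p q r + 5 → TwoOrNone p q r true
4count₃≡3pairs₃+5⇒TwoOrNone true  true  true  ()
4count₃≡3pairs₃+5⇒TwoOrNone true  true  false _ = pq
4count₃≡3pairs₃+5⇒TwoOrNone true  false true  _ = pr
4count₃≡3pairs₃+5⇒TwoOrNone true  false false ()
4count₃≡3pairs₃+5⇒TwoOrNone false true  true  _ = qr
4count₃≡3pairs₃+5⇒TwoOrNone false true  false ()
4count₃≡3pairs₃+5⇒TwoOrNone false false true  ()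
4count₃≡3pairs₃+5⇒TwoOrNone false false false ()

TwoOrNone⇒count₃ : ∀ {p q r l} → TwoOrNone p q r l → count₃ p q r ≡ 2 * 𝟙 l
TwoOrNone⇒count₃ pq   = refl
TwoOrNone⇒count₃ pr   = refl
TwoOrNone⇒count₃ qr   = refl
TwoOrNone⇒count₃ none = refl

TwoOrNone⇒pairs : ∀ {p q r l} → TwoOrNone p q r l → (p ∧ q ∨ p ∧ r) ∨ q ∧ r ≡ l
TwoOrNone⇒pairs pq   = refl
TwoOrNone⇒pairs pr   = refl
TwoOrNone⇒pairs qr   = refl
TwoOrNone⇒pairs none = refl

TwoOrNone⇒pair-counts : ∀ {p q r l} → TwoOrNone p q r l →
  (𝟙 p + 𝟙 q ≡ 𝟙 (p ∧ q) + 𝟙 l) × (𝟙 p + 𝟙 r ≡ 𝟙 (p ∧ r) + 𝟙 l) × (𝟙 q + 𝟙 r ≡ 𝟙 (q ∧ r) + 𝟙 l)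
TwoOrNone⇒pair-counts pq   = refl , refl , refl
TwoOrNone⇒pair-counts pr   = refl , refl , refl
TwoOrNone⇒pair-counts qr   = refl , refl , refl
TwoOrNone⇒pair-counts none = refl , refl , refl

≤4∧≢3∧≢4⇒≤2 : ∀ {d} → d ≤ 4 → d ≢ 3 → d ≢ 4 → d ≤ 2
≤4∧≢3∧≢4⇒≤2 {0} _ _ _   = z≤n
≤4∧≢3∧≢4⇒≤2 {1} _ _ _   = s≤s z≤n
≤4∧≢3∧≢4⇒≤2 {2} _ _ _   = ≤-refl
≤4∧≢3∧≢4⇒≤2 {3} _ d≢3 _ = ⊥-elim (d≢3 refl)
≤4∧≢3∧≢4⇒≤2 {4} _ _ d≢4 = ⊥-elim (d≢4 refl)
≤4∧≢3∧≢4⇒≤2 {suc (suc (suc (suc (suc _))))} (s≤s (s≤s (s≤s (s≤s ()))))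

module Configuration {n} (G : SimpleGraph n) (srg : IsSRG G 40 12 20)
  {K : Subset n} (K-clique : IsClique-of-size G 4 K)
  (K-maximal : ∀ C → IsClique-of-size G 5 C → ¬ (K ⊆ C))
  (∣X₂∣ : ∣ Layer G K 2 ∣ ≡ 60) (∣X₃∣ : ∣ Layer G K 3 ∣ ≡ 0)
  {x₁ x₂ x₃ : Fin n} (x₁≢x₂ : x₁ ≢ x₂) (x₁≢x₃ : x₁ ≢ x₃) (x₂≢x₃ : x₂ ≢ x₃)
  (X₀≡ : Layer G K 0 ≡ (⁅ x₁ ⁆ ∪ ⁅ x₂ ⁆) ∪ ⁅ x₃ ⁆) where

  open SimpleGraph G using (adj)
  open StronglyRegular G srg

  X : ℕ → Subset n
  X = Layer G K

  deg-K : Fin n → ℕ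
  deg-K z = ∣ N G z ∩ K ∣

  lookup-X : ∀ i z → lookup (X i) z ≡ not (lookup K z) ∧ (deg-K z ≡ᵇ i)
  lookup-X i z = lookup∘tabulate _ z

  ∈X⁺ : ∀ {i z} → z ∉ K → deg-K z ≡ i → z ∈ X i
  ∈X⁺ {i} {z} z∉K deg≡i = lookup≡true⇒∈ (begin
    lookup (X i) z
      ≡⟨ lookup-X i z ⟩
    not (lookup K z) ∧ (deg-K z ≡ᵇ i)
      ≡⟨ cong₂ _∧_ (cong not (∉⇒lookup≡false z∉K)) (to T-≡ (≡⇒≡ᵇ _ _ deg≡i)) ⟩
    true ∎)
    where open ≡-Reasoning

  ∈X⁻ : ∀ {i z} → z ∈ X i → z ∉ K × deg-K z ≡ i
  ∈X⁻ {i} {z} z∈X with lookup K z in z∈K? | trans (sym (lookup-X i z)) (∈⇒lookup≡true z∈X)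
  ... | false | deg≡ᵇi = lookup≡false⇒∉ z∈K? , ≡ᵇ⇒≡ _ _ (from T-≡ deg≡ᵇi)

  K-vertex : ∀ {z} → z ∈ K → deg-K z ≡ 3
  K-vertex {z} z∈K = suc-injective (begin
    suc (deg-K z)  ≡⟨ cong (suc ∘ ∣_∣) (clique-vertex G (proj₁ K-clique) z∈K) ⟩
    suc ∣ K - z ∣  ≡⟨ x∈p⇒suc∣p-x∣≡∣p∣ z∈K ⟩
    ∣ K ∣          ≡⟨ proj₂ K-clique ⟩
    4              ∎)
    where open ≡-Reasoning

  outside-K : ∀ {z} → z ∉ K → deg-K z ≤ 2
  outside-K {z} z∉K =
    ≤4∧≢3∧≢4⇒≤2 (≤-trans (∣p∩q∣≤∣q∣ (N G z) K) (≤-reflexive (proj₂ K-clique))) ≢3 ≢4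
    where
      ≢3 : deg-K z ≢ 3
      ≢3 deg≡3 = ∣p∣≡0⇒x∉p ∣X₃∣ (∈X⁺ z∉K deg≡3)
      ≢4 : deg-K z ≢ 4
      ≢4 deg≡4 = K-maximal _
        (clique-extend G K-clique z∉K (∣p∩q∣≡∣q∣⇒q⊆p (trans deg≡4 (sym (proj₂ K-clique)))))
        (x∈p∪q⁺ ∘ inj₁)

  deg-K-decomposition : ∀ z →
    deg-K z + 𝟙 (lookup (X 0) z) ≡ 1 + 2 * 𝟙 (lookup K z) + 𝟙 (lookup (X 2) z)
  deg-K-decomposition z rewrite lookup-X 0 z | lookup-X 2 z with lookup K z in z∈K?
  ... | true = trans (+-identityʳ _) (K-vertex (lookup≡true⇒∈ z∈K?))
  ... | false with deg-K z | outside-K (lookup≡false⇒∉ z∈K?)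
  ...   | 0 | _ = refl
  ...   | 1 | _ = refl
  ...   | 2 | _ = refl
  ...   | suc (suc (suc _)) | s≤s (s≤s ())

  X₀-neighbour : ∀ {x z} → x ∈ X 0 → Adj G x z → z ∈ X 2
  X₀-neighbour {x} {z} x∈X₀ xz = ∈X⁺ (neighbour∉K xz) (trans (sym (+-identityʳ (deg-K z))) deg≡2)
    where
      x∉K : x ∉ K
      x∉K = proj₁ (∈X⁻ x∈X₀)
      deg-x≡0 : deg-K x ≡ 0
      deg-x≡0 = proj₂ (∈X⁻ x∈X₀)

      neighbour∉K : ∀ {y} → Adj G x y → y ∉ K
      neighbour∉K xy y∈K = ∣p∣≡0⇒x∉p deg-x≡0 (x∈p∩q⁺ (from (∈N⇔Adj G) xy , y∈K))

      bounded : ∀ y → 𝟙 (adj x y) * deg-K y ≤ 𝟙 (adj x y) * 2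
      bounded y with adj x y in xy
      ... | true  = *-monoʳ-≤ 1 (outside-K (neighbour∉K xy))
      ... | false = z≤n

      total : ∑N G x deg-K ≡ ∑N G x (λ _ → 2)
      total = begin
        ∑N G x deg-K                 ≡⟨ +-identityʳ _ ⟨
        ∑N G x deg-K + 20 * 0        ≡⟨ cong (λ d → ∑N G x deg-K + 20 * d) deg-x≡0 ⟨
        ∑N G x deg-K + 20 * deg-K x  ≡⟨ ∑N-∣N∩Q∣ K (∉⇒lookup≡false x∉K) ⟩
        12 * deg-K x + 20 * ∣ K ∣    ≡⟨ cong₂ (λ d k → 12 * d + 20 * k) deg-x≡0 (proj₂ K-clique) ⟩
        2 * 40                       ≡⟨ cong (2 *_) (trans (sym (∣N∣ x)) (∣N∣≡∑N G x)) ⟩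
        2 * ∑N G x (λ _ → 1)         ≡⟨ ∑N-* G x 2 (λ _ → 1) ⟨
        ∑N G x (λ _ → 2)             ∎
        where open ≡-Reasoning

      deg≡2 : 1 * deg-K z ≡ 2
      deg≡2 = subst (λ b → 𝟙 b * deg-K z ≡ 𝟙 b * 2) xz (∑-tight bounded total z)

  X₀-independent : ∀ {x y} → x ∈ X 0 → y ∈ X 0 → adj x y ≡ false
  X₀-independent x∈X₀ y∈X₀ = ¬-not λ xy →
    case trans (sym (proj₂ (∈X⁻ (X₀-neighbour x∈X₀ xy)))) (proj₂ (∈X⁻ y∈X₀)) of λ ()

  X₀-∣N∩N∣ : ∀ {x y} → x ∈ X 0 → y ∈ X 0 → x ≢ y → ∣ N G x ∩ N G y ∣ ≡ 20
  X₀-∣N∩N∣ x∈X₀ y∈X₀ x≢y = ∣N∩N∣-nonadjacent x≢y (X₀-independent x∈X₀ y∈X₀)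

  X₀-nonadjacent-outside-X₂ : ∀ {x z} → x ∈ X 0 → lookup (X 2) z ≡ false → adj x z ≡ false
  X₀-nonadjacent-outside-X₂ x∈X₀ z∉X₂ = ¬-not λ xz → lookup≡false⇒∉ z∉X₂ (X₀-neighbour x∈X₀ xz)

  x₁∈X₀ : x₁ ∈ X 0
  x₁∈X₀ = subst (x₁ ∈_) (sym X₀≡) (x∈p∪q⁺ (inj₁ (x∈p∪q⁺ (inj₁ (x∈⁅x⁆ x₁)))))

  x₂∈X₀ : x₂ ∈ X 0
  x₂∈X₀ = subst (x₂ ∈_) (sym X₀≡) (x∈p∪q⁺ (inj₁ (x∈p∪q⁺ (inj₂ (x∈⁅x⁆ x₂)))))

  x₃∈X₀ : x₃ ∈ X 0
  x₃∈X₀ = subst (x₃ ∈_) (sym X₀≡) (x∈p∪q⁺ (inj₂ (x∈⁅x⁆ x₃)))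

  two-of-three : ∀ z → TwoOrNone (adj x₁ z) (adj x₂ z) (adj x₃ z) (lookup (X 2) z)
  two-of-three z with lookup (X 2) z in z∈X₂?
  ... | false rewrite X₀-nonadjacent-outside-X₂ x₁∈X₀ z∈X₂?
                    | X₀-nonadjacent-outside-X₂ x₂∈X₀ z∈X₂?
                    | X₀-nonadjacent-outside-X₂ x₃∈X₀ z∈X₂? = none
  ... | true = 4count₃≡3pairs₃+5⇒TwoOrNone (adj x₁ z) (adj x₂ z) (adj x₃ z)
                 (subst (λ b → 4 * d z ≡ 3 * e z + 5 * 𝟙 b) z∈X₂? (∑-tight bounded total z))
    where
      d e : Fin n → ℕ
      d y = count₃ (adj x₁ y) (adj x₂ y) (adj x₃ y)
      e y = pairs₃ (adj x₁ y) (adj x₂ y) (adj x₃ y)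

      bounded : ∀ y → 4 * d y ≤ 3 * e y + 5 * 𝟙 (lookup (X 2) y)
      bounded y with lookup (X 2) y in y∈X₂?
      ... | true = 4count₃≤3pairs₃+5 (adj x₁ y) (adj x₂ y) (adj x₃ y)
      ... | false rewrite X₀-nonadjacent-outside-X₂ x₁∈X₀ y∈X₂?
                        | X₀-nonadjacent-outside-X₂ x₂∈X₀ y∈X₂?
                        | X₀-nonadjacent-outside-X₂ x₃∈X₀ y∈X₂? = z≤n

      degrees : sum (𝟙 ∘ adj x₁) + sum (𝟙 ∘ adj x₂) + sum (𝟙 ∘ adj x₃) ≡ 40 + 40 + 40
      degrees = cong₂ _+_ (cong₂ _+_ (degree x₁) (degree x₂)) (degree x₃)
        where
          degree : ∀ x → sum (𝟙 ∘ adj x) ≡ 40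
          degree x = trans (sym (∣N∣≡∑ G x)) (∣N∣ x)

      common : 20 + 20 + 20 ≡ sum e
      common = sym (trans
        (∑-distrib-+₃ (λ y → 𝟙 (adj x₁ y) * 𝟙 (adj x₂ y)) (λ y → 𝟙 (adj x₁ y) * 𝟙 (adj x₃ y))
              (λ y → 𝟙 (adj x₂ y) * 𝟙 (adj x₃ y)))
        (cong₂ _+_ (cong₂ _+_ (trans (sym (∣N∩N∣≡∑N G x₁ x₂)) (X₀-∣N∩N∣ x₁∈X₀ x₂∈X₀ x₁≢x₂))
                              (trans (sym (∣N∩N∣≡∑N G x₁ x₃)) (X₀-∣N∩N∣ x₁∈X₀ x₃∈X₀ x₁≢x₃)))
                   (trans (sym (∣N∩N∣≡∑N G x₂ x₃)) (X₀-∣N∩N∣ x₂∈X₀ x₃∈X₀ x₂≢x₃))))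

      total : sum (λ y → 4 * d y) ≡ sum (λ y → 3 * e y + 5 * 𝟙 (lookup (X 2) y))
      total = begin
        sum (λ y → 4 * d y)
          ≡⟨ *-distribˡ-sum 4 d ⟨
        4 * sum d
          ≡⟨ cong (4 *_) (trans (∑-distrib-+₃ (𝟙 ∘ adj x₁) (𝟙 ∘ adj x₂) (𝟙 ∘ adj x₃)) degrees) ⟩
        4 * (40 + 40 + 40)
          ≡⟨ cong₂ (λ c s → 3 * c + 5 * s) common (trans (sym ∣X₂∣) (∣p∣≡∑ (X 2))) ⟩
        3 * sum e + 5 * sum (𝟙 ∘ lookup (X 2))
          ≡⟨ cong₂ _+_ (*-distribˡ-sum 3 e) (*-distribˡ-sum 5 (𝟙 ∘ lookup (X 2))) ⟩
        sum (λ y → 3 * e y) + sum (λ y → 5 * 𝟙 (lookup (X 2) y))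
          ≡⟨ ∑-distrib-+ (λ y → 3 * e y) (λ y → 5 * 𝟙 (lookup (X 2) y)) ⟨
        sum (λ y → 3 * e y + 5 * 𝟙 (lookup (X 2) y)) ∎
        where open ≡-Reasoning

  ∣N∩X₀∣ : ∀ y → ∣ N G y ∩ X 0 ∣ ≡ count₃ (adj x₁ y) (adj x₂ y) (adj x₃ y)
  ∣N∩X₀∣ y = begin
    ∣ N G y ∩ X 0 ∣
      ≡⟨ trans (cong (λ p → ∣ N G y ∩ p ∣) X₀≡) (∣N∩p∣≡∑N G y ((⁅ x₁ ⁆ ∪ ⁅ x₂ ⁆) ∪ ⁅ x₃ ⁆)) ⟩
    ∑N G y (𝟙 ∘ lookup ((⁅ x₁ ⁆ ∪ ⁅ x₂ ⁆) ∪ ⁅ x₃ ⁆))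
      ≡⟨ ∑N-cong G y indicator ⟩
    ∑N G y (λ z → χ x₁ z + χ x₂ z + χ x₃ z)
      ≡⟨ ∑N-+₃ G y (χ x₁) (χ x₂) (χ x₃) ⟩
    ∑N G y (χ x₁) + ∑N G y (χ x₂) + ∑N G y (χ x₃)
      ≡⟨ cong₂ _+_ (cong₂ _+_ (point x₁) (point x₂)) (point x₃) ⟩
    count₃ (adj x₁ y) (adj x₂ y) (adj x₃ y) ∎
    where
      open ≡-Reasoning
      χ : Fin n → Fin n → ℕ
      χ x = 𝟙 ∘ lookup ⁅ x ⁆
      point : ∀ x → ∑N G y (χ x) ≡ 𝟙 (adj x y)
      point x = trans (∑-⁅⁆ (𝟙 ∘ adj y) x) (cong 𝟙 (SimpleGraph.sym G y x))
      disjoint : ∀ {x x′ z} → x ≢ x′ → z ∈ ⁅ x ⁆ → z ∉ ⁅ x′ ⁆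
      disjoint x≢x′ z∈x z∈x′ = x≢x′ (trans (sym (x∈⁅y⁆⇒x≡y _ z∈x)) (x∈⁅y⁆⇒x≡y _ z∈x′))
      indicator : ∀ z → 𝟙 (lookup ((⁅ x₁ ⁆ ∪ ⁅ x₂ ⁆) ∪ ⁅ x₃ ⁆) z) ≡ χ x₁ z + χ x₂ z + χ x₃ z
      indicator z = trans
        (𝟙-lookup-∪ (⁅ x₁ ⁆ ∪ ⁅ x₂ ⁆) ⁅ x₃ ⁆
          λ z∈ → [ disjoint x₁≢x₃ , disjoint x₂≢x₃ ] (x∈p∪q⁻ ⁅ x₁ ⁆ ⁅ x₂ ⁆ z∈))
        (cong (_+ χ x₃ z) (𝟙-lookup-∪ ⁅ x₁ ⁆ ⁅ x₂ ⁆ (disjoint x₁≢x₂)))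

  X₂-degree : ∀ {y} → y ∈ X 2 → ∣ N G y ∩ X 2 ∣ ≡ 22
  X₂-degree {y} y∈X₂ = +-cancelˡ-≡ 44 _ _ (begin
    44 + ∣ N G y ∩ X 2 ∣
      ≡⟨ cong₂ (λ d k → d + 2 * k + ∣ N G y ∩ X 2 ∣) (trans (sym (∣N∣ y)) (∣N∣≡∑N G y))
               (trans (sym deg-y≡2) (∣N∩p∣≡∑N G y K)) ⟩
    ∑N G y one + 2 * ∑N G y χK + ∣ N G y ∩ X 2 ∣
      ≡⟨ cong₂ _+_ (cong (∑N G y one +_) (sym (∑N-* G y 2 χK))) (∣N∩p∣≡∑N G y (X 2)) ⟩
    ∑N G y one + ∑N G y (λ z → 2 * χK z) + ∑N G y χ₂
      ≡⟨ ∑N-+₃ G y one (λ z → 2 * χK z) χ₂ ⟨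
    ∑N G y (λ z → 1 + 2 * χK z + χ₂ z)
      ≡⟨ ∑N-cong G y deg-K-decomposition ⟨
    ∑N G y (λ z → deg-K z + χ₀ z)
      ≡⟨ trans (∑N-+ G y deg-K χ₀) (cong₂ _+_ ∑N-deg-K (sym (∣N∩p∣≡∑N G y (X 0)))) ⟩
    64 + ∣ N G y ∩ X 0 ∣
      ≡⟨ cong (64 +_) (trans (∣N∩X₀∣ y) (TwoOrNone⇒count₃ two)) ⟩
    66 ∎)
    where
      open ≡-Reasoning
      one χK χ₀ χ₂ : Fin n → ℕ
      one _ = 1
      χK = 𝟙 ∘ lookup K
      χ₀ = 𝟙 ∘ lookup (X 0)
      χ₂ = 𝟙 ∘ lookup (X 2)
      y∉K : y ∉ K
      y∉K = proj₁ (∈X⁻ y∈X₂)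
      deg-y≡2 : deg-K y ≡ 2
      deg-y≡2 = proj₂ (∈X⁻ y∈X₂)
      two : TwoOrNone (adj x₁ y) (adj x₂ y) (adj x₃ y) true
      two = subst (TwoOrNone (adj x₁ y) (adj x₂ y) (adj x₃ y)) (∈⇒lookup≡true y∈X₂) (two-of-three y)
      ∑N-deg-K : ∑N G y deg-K ≡ 64
      ∑N-deg-K = +-cancelʳ-≡ 40 _ _ (begin
        ∑N G y deg-K + 40            ≡⟨ cong (λ d → ∑N G y deg-K + 20 * d) deg-y≡2 ⟨
        ∑N G y deg-K + 20 * deg-K y  ≡⟨ ∑N-∣N∩Q∣ K (∉⇒lookup≡false y∉K) ⟩
        12 * deg-K y + 20 * ∣ K ∣    ≡⟨ cong₂ (λ d k → 12 * d + 20 * k) deg-y≡2 (proj₂ K-clique) ⟩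
        64 + 40                      ∎)

  X₁₂∪X₁₃∪X₂₃≡X₂ : ((N G x₁ ∩ N G x₂) ∪ (N G x₁ ∩ N G x₃)) ∪ (N G x₂ ∩ N G x₃) ≡ X 2
  X₁₂∪X₁₃∪X₂₃≡X₂ =
    trans (sym (tabulate∘lookup _)) (trans (tabulate-cong pointwise) (tabulate∘lookup (X 2)))
    where
      N₁₂ N₁₃ N₂₃ : Subset n
      N₁₂ = N G x₁ ∩ N G x₂
      N₁₃ = N G x₁ ∩ N G x₃
      N₂₃ = N G x₂ ∩ N G x₃
      pointwise : ∀ z → lookup ((N₁₂ ∪ N₁₃) ∪ N₂₃) z ≡ lookup (X 2) z
      pointwise z = begin
        lookup ((N₁₂ ∪ N₁₃) ∪ N₂₃) z
          ≡⟨ lookup-∪ (N₁₂ ∪ N₁₃) N₂₃ z ⟩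
        lookup (N₁₂ ∪ N₁₃) z ∨ lookup N₂₃ z
          ≡⟨ cong (_∨ lookup N₂₃ z) (lookup-∪ N₁₂ N₁₃ z) ⟩
        (lookup N₁₂ z ∨ lookup N₁₃ z) ∨ lookup N₂₃ z
          ≡⟨ cong₂ _∨_ (cong₂ _∨_ (lookup-N∩N G x₁ x₂ z) (lookup-N∩N G x₁ x₃ z))
                       (lookup-N∩N G x₂ x₃ z) ⟩
        (adj x₁ z ∧ adj x₂ z ∨ adj x₁ z ∧ adj x₃ z) ∨ adj x₂ z ∧ adj x₃ z
          ≡⟨ TwoOrNone⇒pairs (two-of-three z) ⟩
        lookup (X 2) z ∎
        where open ≡-Reasoning

  common-neighbourhood-cycles : ∀ {u w} → u ∈ X 0 → w ∈ X 0 →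
    (∀ z → 𝟙 (adj u z) + 𝟙 (adj w z) ≡ 𝟙 (adj u z ∧ adj w z) + 𝟙 (lookup (X 2) z)) →
    IsDisjointUnionOfCycles G (N G u ∩ N G w)
  common-neighbourhood-cycles {u} {w} u∈X₀ w∈X₀ split = regular⇒cycles G (N G u ∩ N G w) degree
    where
      degree : IsRegularOn G (N G u ∩ N G w) 2
      degree y y∈ = +-cancelʳ-≡ 22 _ _ (begin
        ∣ N G y ∩ (N G u ∩ N G w) ∣ + 22
          ≡⟨ cong₂ _+_ (∣N∩p∣≡∑N G y (N G u ∩ N G w)) (sym (X₂-degree (X₀-neighbour u∈X₀ uy))) ⟩
        ∑N G y (𝟙 ∘ lookup (N G u ∩ N G w)) + ∣ N G y ∩ X 2 ∣
          ≡⟨ cong₂ _+_ (∑N-cong G y (cong 𝟙 ∘ lookup-N∩N G u w)) (∣N∩p∣≡∑N G y (X 2)) ⟩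
        ∑N G y (λ z → 𝟙 (adj u z ∧ adj w z)) + ∑N G y (𝟙 ∘ lookup (X 2))
          ≡⟨ ∑N-+ G y (λ z → 𝟙 (adj u z ∧ adj w z)) (𝟙 ∘ lookup (X 2)) ⟨
        ∑N G y (λ z → 𝟙 (adj u z ∧ adj w z) + 𝟙 (lookup (X 2) z))
          ≡⟨ ∑N-cong G y split ⟨
        ∑N G y (λ z → 𝟙 (adj u z) + 𝟙 (adj w z))
          ≡⟨ ∑N-+ G y (𝟙 ∘ adj u) (𝟙 ∘ adj w) ⟩
        ∑N G y (𝟙 ∘ adj u) + ∑N G y (𝟙 ∘ adj w)
          ≡⟨ cong₂ _+_ (trans (sym (∣N∩N∣≡∑N G y u)) (∣N∩N∣-adjacent (Adj-sym G uy)))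
                       (trans (sym (∣N∩N∣≡∑N G y w)) (∣N∩N∣-adjacent (Adj-sym G wy))) ⟩
        2 + 22 ∎)
        where
          open ≡-Reasoning
          uy : Adj G u y
          uy = to (∈N⇔Adj G) (proj₁ (x∈p∩q⁻ (N G u) (N G w) y∈))
          wy : Adj G w y
          wy = to (∈N⇔Adj G) (proj₂ (x∈p∩q⁻ (N G u) (N G w) y∈))

lemma2 : (G : SimpleGraph 95) → IsSRG G 40 12 20 →
    (K : Subset 95) → IsClique-of-size G 4 K →
    (∀ C → IsClique-of-size G 5 C → ¬ (K ⊆ C)) →
    ∣ Layer G K 0 ∣ ≡ 3 → ∣ Layer G K 1 ∣ ≡ 28 →
    ∣ Layer G K 2 ∣ ≡ 60 → ∣ Layer G K 3 ∣ ≡ 0 →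
    (x₁ x₂ x₃ : Fin 95) → x₁ ≢ x₂ → x₁ ≢ x₃ → x₂ ≢ x₃ →
    Layer G K 0 ≡ (⁅ x₁ ⁆ ∪ ⁅ x₂ ⁆) ∪ ⁅ x₃ ⁆ →
    IsDisjointUnionOfCycles G (N G x₁ ∩ N G x₂) ×
    IsDisjointUnionOfCycles G (N G x₁ ∩ N G x₃) ×
    IsDisjointUnionOfCycles G (N G x₂ ∩ N G x₃) ×
    IsRegularOn G (((N G x₁ ∩ N G x₂) ∪ (N G x₁ ∩ N G x₃)) ∪ (N G x₂ ∩ N G x₃)) 22
-- The hypotheses |X₀| = 3 (implied by the description of X₀) and |X₁| = 28 are not needed.
lemma2 G srg K K-clique K-maximal _ _ ∣X₂∣ ∣X₃∣ x₁ x₂ x₃ x₁≢x₂ x₁≢x₃ x₂≢x₃ X₀≡ =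
    common-neighbourhood-cycles x₁∈X₀ x₂∈X₀ (proj₁ ∘ TwoOrNone⇒pair-counts ∘ two-of-three)
  , common-neighbourhood-cycles x₁∈X₀ x₃∈X₀ (proj₁ ∘ proj₂ ∘ TwoOrNone⇒pair-counts ∘ two-of-three)
  , common-neighbourhood-cycles x₂∈X₀ x₃∈X₀ (proj₂ ∘ proj₂ ∘ TwoOrNone⇒pair-counts ∘ two-of-three)
  , subst (λ U → IsRegularOn G U 22) (sym X₁₂∪X₁₃∪X₂₃≡X₂) (λ _ → X₂-degree)
  where open Configuration G srg K-clique K-maximal ∣X₂∣ ∣X₃∣ x₁≢x₂ x₁≢x₃ x₂≢x₃ X₀≡
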